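{- For all $G,H\subseteq A$ and every formula $\varphi\in\mathcal{L}_{CoRGAL}$, the formula $\langle[G]\rangle\langle[H]\rangle\varphi\to[\langle A\setminus(G\cup H)\rangle]\varphi$ is valid.
   Context: Fix a finite set $A$ of agents and a countable set $P$ of propositional variables. The language $\mathcal{L}_{CoRGAL}$ is given by $\varphi ::= p \mid \neg\varphi \mid (\varphi\wedge\varphi) \mid K_a\varphi \mid [\varphi]\varphi \mid [G,\varphi]\varphi \mid [\langle G\rangle]\varphi$ with $p\in P$, $a\in A$, $G\subseteq A$; $\langle\varphi\rangle\psi:=\neg[\varphi]\neg\psi$, $\langle[G]\rangle\varphi:=\neg[\langle G\rangle]\neg\varphi$. $\mathcal{L}_{EL}$ is the fragment built only from $p,\neg,\wedge,K_a$. For $G\subseteq A$, $\mathcal{L}_{EL}^G$ is the set of formulas $\bigwedge_{i\in G}K_i\varphi_i$ with each $\varphi_i\in\mathcal{L}_{EL}$; $\psi_G$ denotes an element of $\mathcal{L}_{EL}^G$, $\chi_{A\setminus G}$ one of $\mathcal{L}_{EL}^{A\setminus G}$. An epistemic model is $M=(W,\sim,V)$ with $W\neq\emptyset$, each $\sim_a$ an equivalence relation, $V:P\to\mathcal{P}(W)$. $M^\varphi$ is the restriction of $M$ to the states where $\varphi$ holds. Semantics: $p,\neg,\wedge$ as usual; $K_a\varphi$ true at $w$ iff $\varphi$ true at all $v\sim_a w$; $(M,w)\models[\varphi]\psi$ iff $(M,w)\models\varphi$ implies $(M^\varphi,w)\models\psi$; $(M,w)\models[G,\chi]\varphi$ iff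 $(M,w)\models\chi$ and for all $\psi_G$, $(M,w)\models[\psi_G\wedge\chi]\varphi$; $(M,w)\models[\langle G\rangle]\varphi$ iff for all $\psi_G$ there is $\chi_{A\setminus G}$ with $(M,w)\models\psi_G\to\langle\psi_G\wedge\chi_{A\setminus G}\rangle\varphi$. Equivalently, $(M,w)\models\langle[G]\rangle\varphi$ iff there is $\psi_G$ such that for all $\chi_{A\setminus G}$, $(M,w)\models\psi_G\wedge[\psi_G\wedge\chi_{A\setminus G}]\varphi$. Valid means true at every pointed model. -}

module Defs where

open import Data.Nat using (ℕ)
open import Data.Fin using (Fin)
open import Data.Fin.Subset using (Subset; _∈_; ∁; _∪_)
open import Data.Product using (Σ; _×_; _,_; proj₁; proj₂)
open import Relation.Nullary using (¬_)
open import Relation.Binary.Structures using (IsEquivalence)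
open import Level using (0ℓ)

data Form (n : ℕ) : Set where
  atom : ℕ → Form n
  neg  : Form n → Form n
  and  : Form n → Form n → Form n
  K    : Fin n → Form n → Form n
  ann  : Form n → Form n → Form n
  grp  : Subset n → Form n → Form n → Form n
  coal : Subset n → Form n → Form n

data ELForm (n : ℕ) : Set where
  eatom : ℕ → ELForm n
  eneg  : ELForm n → ELForm n
  eand  : ELForm n → ELForm n → ELForm n
  eK    : Fin n → ELForm n → ELForm n

embEL : ∀ {n} → ELForm n → Form n
embEL (eatom p) = atom p
embEL (eneg φ) = neg (embEL φ)
embEL (eand φ ψ) = and (embEL φ) (embEL ψ)
embEL (eK a φ) = K a (embEL φ)

-- An element ψ_G of L_EL^G, i.e. ⋀_{i∈G} K_i φ_i, is given by the choice
-- of φ_i for every agent i (the entries for i ∉ G are ignored).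
GroupEL : ℕ → Set
GroupEL n = Fin n → ELForm n

_⇒_ : ∀ {n} → Form n → Form n → Form n
φ ⇒ ψ = neg (and φ (neg ψ))

dia : ∀ {n} → Form n → Form n → Form n
dia φ ψ = neg (ann φ (neg ψ))

coalDual : ∀ {n} → Subset n → Form n → Form n
coalDual G φ = neg (coal G (neg φ))

record Model (n : ℕ) : Set₁ where
  field
    W          : Set
    R          : Fin n → W → W → Set
    isEquiv    : ∀ a → IsEquivalence (R a)
    V          : ℕ → W → Set
    inhabitant : W
open Model public

restr : ∀ {n} (M : Model n) (P : W M → Set) → Σ (W M) P → Model n
restr M P x = record
  { W = Σ (W M) P
  ; R = λ a u v → R M a (proj₁ u) (proj₁ v)
  ; isEquiv = λ a → record
      { refl  = IsEquivalence.refl (isEquiv M a)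
      ; sym   = IsEquivalence.sym (isEquiv M a)
      ; trans = IsEquivalence.trans (isEquiv M a) }
  ; V = λ p u → V M p (proj₁ u)
  ; inhabitant = x
  }

satEL : ∀ {n} (M : Model n) → W M → ELForm n → Set
satEL M w (eatom p) = V M p w
satEL M w (eneg φ) = ¬ satEL M w φ
satEL M w (eand φ ψ) = satEL M w φ × satEL M w ψ
satEL M w (eK a φ) = ∀ v → R M a w v → satEL M v φ

satG : ∀ {n} (M : Model n) → Subset n → GroupEL n → W M → Set
satG M G ψ w = ∀ i → i ∈ G → satEL M w (eK i (ψ i))

sat : ∀ {n} (M : Model n) → W M → Form n → Set
sat M w (atom p) = V M p w
sat M w (neg φ) = ¬ sat M w φ
sat M w (and φ ψ) = sat M w φ × sat M w ψ
sat M w (K a φ) = ∀ v → R M a w v → sat M v φ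
sat M w (ann φ ψ) =
  (p : sat M w φ) → sat (restr M (λ v → sat M v φ) (w , p)) (w , p) ψ
sat M w (grp G χ φ) =
  sat M w χ ×
  ((ψ : GroupEL _) → (p : satG M G ψ w × sat M w χ) →
     sat (restr M (λ v → satG M G ψ v × sat M v χ) (w , p)) (w , p) φ)
-- (M,w) ⊨ [⟨G⟩]φ  iff  for all ψ_G there is χ_{A∖G} with
--   (M,w) ⊨ ψ_G → ⟨ψ_G ∧ χ_{A∖G}⟩φ,   where ⟨θ⟩φ = ¬[θ]¬φ
sat M w (coal G φ) =
  (ψ : GroupEL _) → Σ (GroupEL _) λ χ →
    satG M G ψ w →
    ¬ ((p : satG M G ψ w × satG M (∁ G) χ w) →
         ¬ sat (restr M (λ v → satG M G ψ v × satG M (∁ G) χ v) (w , p)) (w , p) φ)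

Valid : ∀ {n} → Form n → Set₁
Valid {n} φ = (M : Model n) (w : W M) → sat M w φ

module Submission where

-- Suppose ⟨[G]⟩⟨[H]⟩φ holds at (M,w) and the coalition C announces
-- some ψ_C that is true at w.  The hypothesis yields a ψ_G that works against
-- every reply of A ∖ G; we let A ∖ G reply with ψ_C on C and ⊤ on H.  In the
-- updated model M₁ the hypothesis ⟨[H]⟩φ yields a ψ_H, and we let A ∖ H reply
-- with ⊤, so φ holds after the two announcements.  The reply of A ∖ C = G ∪ H
-- to ψ_C is then agentwise ψ_G on G and ψ_H relativised to M₁ on H; the single
-- announcement of ψ_C together with this reply removes exactly the states the
-- two successive announcements remove.
--
-- Excluded middle is used to unfold the
-- coalition modalities and in the relativisation of knowledge.

open import Defs
open import Axiom.ExcludedMiddle using (ExcludedMiddle)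
open import Axiom.DoubleNegationElimination using (em⇒dne)
open import Data.Empty using (⊥-elim)
open import Data.Fin using (Fin; zero; suc)
open import Data.Fin.Subset using (Subset; ∁; _∪_; _∈_)
open import Data.Fin.Subset.Properties using (_∈?_; x∈∁p⇒x∉p; x∉p⇒x∈∁p; x∈p∪q⁺)
open import Data.Nat using (ℕ; zero; suc)
open import Data.Product using (Σ; Σ-syntax; _×_; _,_; proj₁; proj₂)
open import Data.Sum using (inj₁; inj₂)
open import Function using (flip)
open import Function.Bundles using (_⇔_; mk⇔; module Equivalence)
open import Level using (0ℓ)
open import Relation.Nullary using (¬_; Dec; yes; no; contradiction)
open import Relation.Binary.PropositionalEquality using (_≡_; refl; sym; subst)

open Equivalence using (to; from)

joint : ∀ {n} (M : Model n) (G : Subset n) → GroupEL n → GroupEL n → W M → Set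
joint M G ψ χ v = satG M G ψ v × satG M (∁ G) χ v

record Bisim {n} (M N : Model n) (Z : W M → W N → Set) : Set where
  field
    atoms  : ∀ {u v} p → Z u v → V M p u → V N p v
    atomsᵒ : ∀ {u v} p → Z u v → V N p v → V M p u
    forth  : ∀ {u v} a u' → Z u v → R M a u u' → Σ[ v' ∈ W N ] R N a v v' × Z u' v'
    back   : ∀ {u v} a v' → Z u v → R N a v v' → Σ[ u' ∈ W M ] R M a u u' × Z u' v'
open Bisim

bisim-sym : ∀ {n} {M N : Model n} {Z} → Bisim M N Z → Bisim N M (flip Z)
bisim-sym B = record { atoms = atomsᵒ B ; atomsᵒ = atoms B ; forth = back B ; back = forth B }

bisim-restr : ∀ {n} {M N : Model n} {Z} → Bisim M N Z →
  (P : W M → Set) (Q : W N → Set) →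
  (∀ {u v} → Z u v → P u → Q v) → (∀ {u v} → Z u v → Q v → P u) →
  (x : Σ (W M) P) (y : Σ (W N) Q) →
  Bisim (restr M P x) (restr N Q y) (λ u v → Z (proj₁ u) (proj₁ v))
bisim-restr B P Q P⇒Q Q⇒P x y = record
  { atoms  = λ p z → atoms B p z
  ; atomsᵒ = λ p z → atomsᵒ B p z
  ; forth  = λ a u' z r → let (v' , r' , z') = forth B a (proj₁ u') z r
                          in (v' , P⇒Q z' (proj₂ u')) , r' , z'
  ; back   = λ a v' z r → let (u' , r' , z') = back B a (proj₁ v') z r
                          in (u' , Q⇒P z' (proj₂ v')) , r' , z'
  }

bisim-satEL : ∀ {n} {M N : Model n} {Z} → Bisim M N Z →
  (θ : ELForm n) → ∀ {u v} → Z u v → satEL M u θ → satEL N v θ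
bisim-satEL B (eatom p) z s = atoms B p z s
bisim-satEL B (eneg θ) z s = λ t → s (bisim-satEL (bisim-sym B) θ z t)
bisim-satEL B (eand θ θ') z (s , s') = bisim-satEL B θ z s , bisim-satEL B θ' z s'
bisim-satEL B (eK a θ) z s v' r =
  let (u' , r' , z') = back B a v' z r in bisim-satEL B θ z' (s u' r')

bisim-satG : ∀ {n} {M N : Model n} {Z} → Bisim M N Z →
  (S : Subset n) (ψ : GroupEL n) → ∀ {u v} → Z u v → satG M S ψ u → satG N S ψ v
bisim-satG B S ψ z s i i∈S = bisim-satEL B (eK i (ψ i)) z (s i i∈S)

-- All of L_CoRGAL is bisimulation invariant: the announcement clauses follow
-- because a bisimulation restricts to the announced submodels.
bisim-sat : ∀ {n} {M N : Model n} {Z} → Bisim M N Z →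
  (φ : Form n) → ∀ {u v} → Z u v → sat M u φ → sat N v φ
bisim-sat B (atom p) z s = atoms B p z s
bisim-sat B (neg φ) z s = λ t → s (bisim-sat (bisim-sym B) φ z t)
bisim-sat B (and φ ψ) z (s , t) = bisim-sat B φ z s , bisim-sat B ψ z t
bisim-sat B (K a φ) z s v' r =
  let (u' , r' , z') = back B a v' z r in bisim-sat B φ z' (s u' r')
bisim-sat {M = M} {N} B (ann χ φ) {u} {v} z s q =
  bisim-sat (bisim-restr B (λ x → sat M x χ) (λ y → sat N y χ)
               (bisim-sat B χ) (bisim-sat (bisim-sym B) χ) (u , p) (v , q)) φ z (s p)
  where
  p : sat M u χ
  p = bisim-sat (bisim-sym B) χ z q
bisim-sat {M = M} {N} {Z} B (grp G χ φ) {u} {v} z (sχ , s) = bisim-sat B χ z sχ , after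
  where
  after : ∀ ψ (q : satG N G ψ v × sat N v χ) →
    sat (restr N (λ y → satG N G ψ y × sat N y χ) (v , q)) (v , q) φ
  after ψ (qψ , qχ) = bisim-sat (bisim-restr B _ _ to-N to-M (u , p) (v , (qψ , qχ))) φ z (s ψ p)
    where
    to-N : ∀ {x y} → Z x y → satG M G ψ x × sat M x χ → satG N G ψ y × sat N y χ
    to-N z' (a , b) = bisim-satG B G ψ z' a , bisim-sat B χ z' b
    to-M : ∀ {x y} → Z x y → satG N G ψ y × sat N y χ → satG M G ψ x × sat M x χ
    to-M z' (a , b) = bisim-satG (bisim-sym B) G ψ z' a , bisim-sat (bisim-sym B) χ z' b
    p : satG M G ψ u × sat M u χ
    p = to-M z (qψ , qχ)
bisim-sat {M = M} {N} {Z} B (coal G φ) {u} {v} z s ψ = χ , λ sψ k →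
  proj₂ (s ψ) (bisim-satG (bisim-sym B) G ψ z sψ) λ p t →
    k (to-N z p) (bisim-sat (bisim-restr B _ _ to-N to-M (u , p) (v , to-N z p)) φ z t)
  where
  χ : GroupEL _
  χ = proj₁ (s ψ)
  to-N : ∀ {x y} → Z x y → joint M G ψ χ x → joint N G ψ χ y
  to-N z' (a , b) = bisim-satG B G ψ z' a , bisim-satG B (∁ G) χ z' b
  to-M : ∀ {x y} → Z x y → joint N G ψ χ y → joint M G ψ χ x
  to-M z' (a , b) = bisim-satG (bisim-sym B) G ψ z' a , bisim-satG (bisim-sym B) (∁ G) χ z' b

restr-restr : ∀ {n} (M : Model n) (P : W M → Set) (R : Σ (W M) P → Set) (Q : W M → Set) →
  (∀ {v} (p : P v) → R (v , p) → Q v) → (∀ {v} → Q v → Σ[ p ∈ P v ] R (v , p)) →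
  (x : Σ (W M) P) (y : Σ (Σ (W M) P) R) (z : Σ (W M) Q) →
  Bisim (restr (restr M P x) R y) (restr M Q z) (λ u u' → proj₁ (proj₁ u) ≡ proj₁ u')
restr-restr M P R Q PR⇒Q Q⇒PR x y z = record
  { atoms  = λ p e s → subst (V M p) e s
  ; atomsᵒ = λ p e s → subst (V M p) (sym e) s
  ; forth  = λ a ((u' , p') , r') e r →
      (u' , PR⇒Q p' r') , subst (λ t → Model.R M a t u') e r , refl
  ; back   = λ a (u' , q') e r →
      ((u' , proj₁ (Q⇒PR q')) , proj₂ (Q⇒PR q')) , subst (λ t → Model.R M a t u') (sym e) r , refl
  }

⊤EL : ∀ {n} → ELForm n
⊤EL = eneg (eand (eatom 0) (eneg (eatom 0)))

⊤EL-true : ∀ {n} (M : Model n) v → satEL M v ⊤EL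
⊤EL-true M v (p , ¬p) = ¬p p

satG-⊤ : ∀ {n} (M : Model n) (S : Subset n) v → satG M S (λ _ → ⊤EL) v
satG-⊤ M S v i _ u _ = ⊤EL-true M u

knows-and : ∀ {n} (M : Model n) v (i : Fin n) (θ θ' : ELForm n) →
  satEL M v (eK i (eand θ θ')) ⇔ (satEL M v (eK i θ) × satEL M v (eK i θ'))
knows-and M v i θ θ' =
  mk⇔ (λ k → (λ u r → proj₁ (k u r)) , (λ u r → proj₂ (k u r)))
      (λ (k , k') u r → k u r , k' u r)

select : ∀ {n} {P : Set} → Dec P → ELForm n → ELForm n
select (yes _) θ = θ
select (no _)  _ = ⊤EL

knows-select : ∀ {n} (M : Model n) v (i : Fin n) {P : Set} (d : Dec P) (θ : ELForm n) →
  satEL M v (eK i (select d θ)) ⇔ (P → satEL M v (eK i θ))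
knows-select M v i (yes p) θ = mk⇔ (λ k _ → k) (λ f → f p)
knows-select M v i (no ¬p) θ = mk⇔ (λ _ p → contradiction p ¬p) (λ _ u _ → ⊤EL-true M u)

mask : ∀ {n} → Subset n → GroupEL n → GroupEL n
mask S ψ i = select (i ∈? S) (ψ i)

knows-mask : ∀ {n} (M : Model n) v (S : Subset n) (ψ : GroupEL n) (i : Fin n) →
  satEL M v (eK i (mask S ψ i)) ⇔ (i ∈ S → satEL M v (eK i (ψ i)))
knows-mask M v S ψ i = knows-select M v i (i ∈? S) (ψ i)

bigAnd : ∀ {n} (k : ℕ) → (Fin k → ELForm n) → ELForm n
bigAnd zero    f = ⊤EL
bigAnd (suc k) f = eand (f zero) (bigAnd k (λ i → f (suc i)))

satEL-bigAnd : ∀ {n} (M : Model n) v (k : ℕ) (f : Fin k → ELForm n) →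
  satEL M v (bigAnd k f) ⇔ (∀ i → satEL M v (f i))
satEL-bigAnd M v zero f = mk⇔ (λ _ ()) (λ _ → ⊤EL-true M v)
satEL-bigAnd M v (suc k) f = mk⇔
  (λ { (s , ss) zero → s ; (s , ss) (suc i) → to IH ss i })
  (λ s → s zero , from IH (λ i → s (suc i)))
  where
  IH : satEL M v (bigAnd k (λ i → f (suc i))) ⇔ (∀ i → satEL M v (f (suc i)))
  IH = satEL-bigAnd M v k (λ i → f (suc i))

groupFormula : ∀ {n} → Subset n → GroupEL n → ELForm n
groupFormula {n} S ψ = bigAnd n (λ i → eK i (mask S ψ i))

satEL-groupFormula : ∀ {n} (M : Model n) v (S : Subset n) (ψ : GroupEL n) →
  satEL M v (groupFormula S ψ) ⇔ satG M S ψ v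
satEL-groupFormula {n} M v S ψ = mk⇔
  (λ s i → to (knows-mask M v S ψ i) (to conj s i))
  (λ s → from conj (λ i → from (knows-mask M v S ψ i) (s i)))
  where
  conj : satEL M v (groupFormula S ψ) ⇔ (∀ i → satEL M v (eK i (mask S ψ i)))
  conj = satEL-bigAnd M v n (λ i → eK i (mask S ψ i))

Defines : ∀ {n} (M : Model n) → ELForm n → (W M → Set) → Set
Defines M ρ P = ∀ v → satEL M v ρ ⇔ P v

relativize : ∀ {n} → ELForm n → ELForm n → ELForm n
relativize ρ (eatom p)   = eatom p
relativize ρ (eneg θ)    = eneg (relativize ρ θ)
relativize ρ (eand θ θ') = eand (relativize ρ θ) (relativize ρ θ')
relativize ρ (eK a θ)    = eK a (eneg (eand ρ (eneg (relativize ρ θ))))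

relativizeK : ∀ {n} → ELForm n → ELForm n → ELForm n
relativizeK ρ θ = eneg (eand ρ (eneg (relativize ρ θ)))

module _ (em : ExcludedMiddle 0ℓ) where

  private
    dne : {P : Set} → ¬ ¬ P → P
    dne = em⇒dne em

    ¬∀⇒∃¬ : {A : Set} {Q : A → Set} → ¬ (∀ a → Q a) → Σ[ a ∈ A ] ¬ Q a
    ¬∀⇒∃¬ h = dne λ k → h λ a → dne λ ¬q → k (a , ¬q)

    ¬→⇒×¬ : {P Q : Set} → ¬ (P → Q) → P × ¬ Q
    ¬→⇒×¬ h = dne (λ ¬p → h (λ p → ⊥-elim (¬p p))) , λ q → h (λ _ → q)

  satEL-relativize : ∀ {n} (M : Model n) (P : W M → Set) (x : Σ (W M) P) (ρ : ELForm n) →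
    Defines M ρ P → ∀ θ v (p : P v) →
    satEL (restr M P x) (v , p) θ ⇔ satEL M v (relativize ρ θ)
  satEL-relativize M P x ρ def (eatom a) v p = mk⇔ (λ s → s) (λ s → s)
  satEL-relativize M P x ρ def (eneg θ) v p =
    let IH = satEL-relativize M P x ρ def θ v p in
    mk⇔ (λ s t → s (from IH t)) (λ s t → s (to IH t))
  satEL-relativize M P x ρ def (eand θ θ') v p =
    let IH = satEL-relativize M P x ρ def θ v p
        IH' = satEL-relativize M P x ρ def θ' v p in
    mk⇔ (λ (s , s') → to IH s , to IH' s') (λ (s , s') → from IH s , from IH' s')
  satEL-relativize M P x ρ def (eK a θ) v p = mk⇔
    (λ k v' r (sρ , ¬θ) → ¬θ (to (IH v' (to (def v') sρ)) (k (v' , to (def v') sρ) r)))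
    (λ k (v' , p') r → from (IH v' p') (dne (λ ¬θ → k v' r (from (def v') p' , ¬θ))))
    where
    IH : ∀ v' (p' : P v') → satEL (restr M P x) (v' , p') θ ⇔ satEL M v' (relativize ρ θ)
    IH = satEL-relativize M P x ρ def θ

  satG-relativize : ∀ {n} (M : Model n) (P : W M → Set) (x : Σ (W M) P) (ρ : ELForm n) →
    Defines M ρ P → (S : Subset n) (ψ : GroupEL n) → ∀ v (p : P v) →
    satG (restr M P x) S ψ (v , p) ⇔ satG M S (λ i → relativizeK ρ (ψ i)) v
  satG-relativize M P x ρ def S ψ v p = mk⇔
    (λ s i i∈S → to (knowsᵢ i) (s i i∈S))
    (λ s i i∈S → from (knowsᵢ i) (s i i∈S))
    where
    knowsᵢ : ∀ i → satEL (restr M P x) (v , p) (eK i (ψ i)) ⇔ satEL M v (eK i (relativizeK ρ (ψ i)))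
    knowsᵢ i = satEL-relativize M P x ρ def (eK i (ψ i)) v p

  coalDual-elim : ∀ {n} {M : Model n} {w : W M} (G : Subset n) (θ : Form n) →
    sat M w (coalDual G θ) →
    Σ[ ψ ∈ GroupEL n ] satG M G ψ w ×
      ((χ : GroupEL n) (p : joint M G ψ χ w) → sat (restr M (joint M G ψ χ) (w , p)) (w , p) θ)
  coalDual-elim {n} {M} {w} G θ hyp =
    ψ , proj₁ (defeats (λ _ → ⊤EL)) , λ χ p → dne (λ ¬θ → proj₂ (defeats χ) (λ f → f p ¬θ))
    where
    ψ : GroupEL n
    ψ = proj₁ (¬∀⇒∃¬ hyp)
    -- no reply χ refutes θ after ψ ∧ χ
    defeats : (χ : GroupEL n) → satG M G ψ w ×
      ¬ ¬ ((p : joint M G ψ χ w) → ¬ ¬ sat (restr M (joint M G ψ χ) (w , p)) (w , p) θ)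
    defeats χ = ¬→⇒×¬ (λ f → proj₂ (¬∀⇒∃¬ hyp) (χ , f))

  coal-intro : ∀ {n} {M : Model n} {w : W M} (G : Subset n) (φ : Form n) →
    ((ψ : GroupEL n) → satG M G ψ w →
      Σ[ χ ∈ GroupEL n ] Σ[ p ∈ joint M G ψ χ w ] sat (restr M (joint M G ψ χ) (w , p)) (w , p) φ) →
    sat M w (coal G φ)
  coal-intro {M = M} {w} G φ h ψ with em {satG M G ψ w}
  ... | yes s = let (χ , p , t) = h ψ s in χ , λ _ k → k p t
  ... | no ¬s = (λ _ → ⊤EL) , λ s _ → ¬s s

  module Replies {n} (G H : Subset n) (M : Model n) (ψC ψG : GroupEL n) where

    C : Subset n
    C = ∁ (G ∪ H)

    χ₁ : GroupEL n
    χ₁ = mask C ψC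

    P₁ : W M → Set
    P₁ = joint M G ψG χ₁

    P₁-holds : ∀ v → satG M G ψG v → satG M C ψC v → P₁ v
    P₁-holds v sG sC = sG , λ i _ → from (knows-mask M v C ψC i) (sC i)

    ρ₁ : ELForm n
    ρ₁ = eand (groupFormula G ψG) (groupFormula (∁ G) χ₁)

    ρ₁-defines : Defines M ρ₁ P₁
    ρ₁-defines v = mk⇔
      (λ (a , b) → to (satEL-groupFormula M v G ψG) a , to (satEL-groupFormula M v (∁ G) χ₁) b)
      (λ (a , b) → from (satEL-groupFormula M v G ψG) a , from (satEL-groupFormula M v (∁ G) χ₁) b)

    ψH↓ : GroupEL n → GroupEL n
    ψH↓ ψH i = relativizeK ρ₁ (ψH i)

    χ : GroupEL n → GroupEL n
    χ ψH i = eand (mask G ψG i) (mask H (ψH↓ ψH) i)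

    C⇒∉G : ∀ {i} → i ∈ C → ¬ i ∈ G
    C⇒∉G c g = x∈∁p⇒x∉p c (x∈p∪q⁺ (inj₁ g))

    C⇒∉H : ∀ {i} → i ∈ C → ¬ i ∈ H
    C⇒∉H c h = x∈∁p⇒x∉p c (x∈p∪q⁺ (inj₂ h))

    agentwise : ∀ ψH v i → let k = λ θ → satEL M v (eK i θ) in
      ((i ∈ C → k (ψC i)) × (i ∈ ∁ C → k (χ ψH i))) ⇔
      ((i ∈ G → k (ψG i)) × (i ∈ ∁ G → k (χ₁ i)) × (i ∈ H → k (ψH↓ ψH i)))
    agentwise ψH v i = mk⇔
      (λ (qC , q∁C) →
         (λ g → to mG (proj₁ (to both (q∁C (x∉p⇒x∈∁p (λ c → C⇒∉G c g))))) g) ,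
         (λ _ → from mC qC) ,
         (λ h → to mH (proj₂ (to both (q∁C (x∉p⇒x∈∁p (λ c → C⇒∉H c h))))) h))
      (λ (pG , p∁G , pH) →
         (λ c → to mC (p∁G (x∉p⇒x∈∁p (C⇒∉G c))) c) ,
         (λ _ → from both (from mG pG , from mH pH)))
      where
      k : ELForm n → Set
      k θ = satEL M v (eK i θ)
      mC : k (mask C ψC i) ⇔ (i ∈ C → k (ψC i))
      mC = knows-mask M v C ψC i
      mG : k (mask G ψG i) ⇔ (i ∈ G → k (ψG i))
      mG = knows-mask M v G ψG i
      mH : k (mask H (ψH↓ ψH) i) ⇔ (i ∈ H → k (ψH↓ ψH i))
      mH = knows-mask M v H (ψH↓ ψH) i
      both : k (χ ψH i) ⇔ (k (mask G ψG i) × k (mask H (ψH↓ ψH) i))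
      both = knows-and M v i (mask G ψG i) (mask H (ψH↓ ψH) i)

    single⇔successive : ∀ ψH v → joint M C ψC (χ ψH) v ⇔ (P₁ v × satG M H (ψH↓ ψH) v)
    single⇔successive ψH v = mk⇔
      (λ (qC , q∁C) → let r = λ i → to (agentwise ψH v i) (qC i , q∁C i) in
         ((λ i → proj₁ (r i)) , (λ i → proj₁ (proj₂ (r i)))) , (λ i → proj₂ (proj₂ (r i))))
      (λ ((pG , p∁G) , pH) → let r = λ i → from (agentwise ψH v i) (pG i , p∁G i , pH i) in
         (λ i → proj₁ (r i)) , (λ i → proj₂ (r i)))

    collapse : (x : Σ (W M) P₁) (ψH : GroupEL n) →
      let M₁ = restr M P₁ x ; P₂ = joint M₁ H ψH (λ _ → ⊤EL) ; Q = joint M C ψC (χ ψH) in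
      (y : Σ (W M₁) P₂) (z : Σ (W M) Q) →
      Bisim (restr M₁ P₂ y) (restr M Q z) (λ u u' → proj₁ (proj₁ u) ≡ proj₁ u')
    collapse x ψH = restr-restr M P₁ _ _
      (λ {v} p (sH , _) → from (single⇔successive ψH v) (p , to (↓ v p) sH))
      (λ {v} q → let (p , sH↓) = to (single⇔successive ψH v) q in
                 p , from (↓ v p) sH↓ , satG-⊤ (restr M P₁ x) (∁ H) (v , p))
      x
      where
      ↓ : ∀ v (p : P₁ v) → satG (restr M P₁ x) H ψH (v , p) ⇔ satG M H (ψH↓ ψH) v
      ↓ = satG-relativize M P₁ x ρ₁ ρ₁-defines H ψH

    -- After ψ_G ∧ χ₁, the hypothesis ⟨[H]⟩φ provides ψ_H; replying ⊤ to it,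
    -- φ holds after the two announcements, hence after ψ_C ∧ χ ψ_H.
    reply-of-G∪H : ∀ {w} (p₁ : P₁ w) (φ : Form n) → sat (restr M P₁ (w , p₁)) (w , p₁) (coalDual H φ) →
      Σ[ χ' ∈ GroupEL n ] Σ[ q ∈ joint M C ψC χ' w ] sat (restr M (joint M C ψC χ') (w , q)) (w , q) φ
    reply-of-G∪H {w} p₁ φ hypH with coalDual-elim H φ hypH
    ... | ψH , sH , afterH =
      χ ψH , q , bisim-sat (collapse (w , p₁) ψH ((w , p₁) , p₂) (w , q)) φ refl (afterH (λ _ → ⊤EL) p₂)
      where
      p₂ : joint (restr M P₁ (w , p₁)) H ψH (λ _ → ⊤EL) (w , p₁)
      p₂ = sH , satG-⊤ (restr M P₁ (w , p₁)) (∁ H) (w , p₁)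
      q : joint M C ψC (χ ψH) w
      q = from (single⇔successive ψH w)
            (p₁ , to (satG-relativize M P₁ (w , p₁) ρ₁ ρ₁-defines H ψH w p₁) sH)

proposition6 : ExcludedMiddle 0ℓ → (n : ℕ) (G H : Subset n) (φ : Form n) →
    Valid ((coalDual G (coalDual H φ)) ⇒ (coal (∁ (G ∪ H)) φ))
proposition6 em n G H φ M w (hyp , ¬conclusion) = ¬conclusion (coal-intro em (∁ (G ∪ H)) φ reply)
  where
  reply : (ψC : GroupEL n) → satG M (∁ (G ∪ H)) ψC w →
    Σ[ χ ∈ GroupEL n ] Σ[ q ∈ joint M (∁ (G ∪ H)) ψC χ w ]
      sat (restr M (joint M (∁ (G ∪ H)) ψC χ) (w , q)) (w , q) φ
  reply ψC sC with coalDual-elim em G (coalDual H φ) hyp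
  ... | ψG , sG , afterG = reply-of-G∪H p₁ φ (afterG χ₁ p₁)
    where
    open Replies em G H M ψC ψG
    p₁ : P₁ w
    p₁ = P₁-holds w sG sC
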